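{- Let $m$ be a positive integer. Every positive integer solution $n$ of \[\sigma_2(n)-n^2=L_{2m}\,n+(L_{2m}^2-3)\] with $n>(L_{2m}^2+L_{2m}-3)^3$ is of the form $n=L_{2k-1}L_{2k+2m-1}$ for some positive integer $k$, where both $L_{2k-1}$ and $L_{2k+2m-1}$ are primes.
   Context: $\sigma_2(n)=\sum_{d\mid n}d^2$. $L_n$ are the Lucas numbers: $L_0=2$, $L_1=1$, $L_n=L_{n-1}+L_{n-2}$. A Lucas prime is a Lucas number that is prime. -}

module Defs where

open import Data.Nat using (ℕ; zero; suc; _+_; _*_; _^_)
open import Data.Nat.Divisibility using (_∣?_)
open import Data.List using (List; filter; map; upTo)
open import Data.Nat.ListAction using (sum)

L : ℕ → ℕ
L zero = 2
L (suc zero) = 1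
L (suc (suc n)) = L (suc n) + L n

divisors : ℕ → List ℕ
divisors n = filter (_∣? n) (map suc (upTo n))

σ₂ : ℕ → ℕ
σ₂ n = sum (map (λ d → d ^ 2) (divisors n))

-- Write A = L₂ₘ ≥ 3 and let p be the least prime factor of n. If n is prime or n = p², then
-- σ₂(n) ≤ 1 + n + n², far below n² + A n + A² − 3. If n = p t with t composite, then p² ≤ t, so
-- n² ≤ t³, while σ₂(n) ≥ 1 + t² + n² gives t² < (A + 1) n; together n < (A + 1)³, excluded by the
-- size hypothesis. Hence n = p q with primes p < q, and σ₂(n) = 1 + p² + q² + n² turns the
-- equation into p² + q² + 4 = A p q + A². As a quadratic in q its discriminant is
-- (A² − 4)(p² + 4) = 5 F₂ₘ² (p² + 4), so p² + 4 = 5 f². Then u = (p + f) / 2 satisfies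
-- u² − u f − f² = −1, and descent along Cassini's identity makes (u , f) a pair of consecutive
-- Fibonacci numbers: p = L₂ₖ₋₁. The addition formula 2 L_(a+b) = L_a L_b + 5 F_a F_b shows the
-- larger root is L₂ₖ₊₂ₘ₋₁, and Vieta's formulas rule out the smaller one since q > p.

module Submission where

open import Defs
open import Data.Nat using (ℕ; _+_; _*_; _^_; _∸_; _<_; _>_)
open import Data.Nat.Primality using (Prime)
open import Data.Product using (Σ; _×_)
open import Relation.Binary.PropositionalEquality using (_≡_)

open import Algebra.Properties.CommutativeSemigroup using (interchange)
open import Data.Empty using (⊥-elim)
open import Data.List using ([]; _∷_; _++_; filter; map; upTo)
open import Data.List.Membership.Propositional using (_∈_)
open import Data.List.Properties using (upTo-∷ʳ; map-++; filter-++; filter-accept; filter-reject)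
open import Data.List.Relation.Unary.All as All using (All; []; _∷_)
open import Data.List.Relation.Unary.Any using (here; there)
open import Data.Nat
open import Data.Nat.Coprimality using (Coprime; coprime-/gcd; coprime-divisor)
open import Data.Nat.Divisibility
open import Data.Nat.DivMod using (m/n*n≡m)
open import Data.Nat.GCD using (gcd; gcd[m,n]∣m; gcd[m,n]∣n; gcd[m,n]≢0)
open import Data.Nat.Induction using (<-wellFounded)
open import Data.Nat.ListAction using (sum)
open import Data.Nat.ListAction.Properties using (sum-++)
open import Data.Nat.Primality
  using (_Rough_; 2-rough; ∤⇒rough-suc; rough⇒≤; rough∧∣⇒rough; rough∧∣⇒prime; ¬prime⇒composite;
         euclidsLemma; prime[2]; prime?; prime⇒nonZero; prime⇒irreducible)
open import Data.Nat.Properties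
open import Data.Nat.Tactic.RingSolver using (solve-∀)
open import Data.Product using (_,_)
open import Data.Sum using (_⊎_; inj₁; inj₂; reduce)
open import Function.Bundles using (_⇔_; mk⇔; Equivalence)
open import Induction.WellFounded using (Acc; acc)
open import Relation.Binary.PropositionalEquality
open import Relation.Nullary using (¬_; yes; no)
open import Relation.Nullary.Decidable using (from-yes)

-- Fibonacci and Lucas numbers

F : ℕ → ℕ
F 0 = 0
F 1 = 1
F (suc (suc n)) = F (suc n) + F n

record FibonacciLike (f : ℕ → ℕ) : Set where
  constructor fibonacciLike
  field recurrence : ∀ n → f (2 + n) ≡ f (1 + n) + f n
open FibonacciLike

F-fibonacciLike : FibonacciLike F
F-fibonacciLike = fibonacciLike λ n → refl

L-fibonacciLike : FibonacciLike L
L-fibonacciLike = fibonacciLike λ n → refl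

suc-fibonacciLike : ∀ {f} → FibonacciLike f → FibonacciLike (λ n → f (suc n))
suc-fibonacciLike rf = fibonacciLike λ n → recurrence rf (suc n)

+ʳ-fibonacciLike : ∀ k {f} → FibonacciLike f → FibonacciLike (λ n → f (n + k))
+ʳ-fibonacciLike k rf = fibonacciLike λ n → recurrence rf (n + k)

+-fibonacciLike : ∀ {f g} → FibonacciLike f → FibonacciLike g → FibonacciLike (λ n → f n + g n)
+-fibonacciLike {f} {g} rf rg = fibonacciLike λ n →
  trans (cong₂ _+_ (recurrence rf n) (recurrence rg n)) (interchange +-commutativeSemigroup (f (1 + n)) (f n) (g (1 + n)) (g n))

*ˡ-fibonacciLike : ∀ c {f} → FibonacciLike f → FibonacciLike (λ n → c * f n)
*ˡ-fibonacciLike c {f} rf = fibonacciLike λ n → trans (cong (c *_) (recurrence rf n)) (*-distribˡ-+ c (f (1 + n)) (f n))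

*ʳ-fibonacciLike : ∀ c {f} → FibonacciLike f → FibonacciLike (λ n → f n * c)
*ʳ-fibonacciLike c {f} rf = fibonacciLike λ n → trans (cong (_* c) (recurrence rf n)) (*-distribʳ-+ c (f (1 + n)) (f n))

fibonacciLike-unique : ∀ {f g} → FibonacciLike f → FibonacciLike g →
                       f 0 ≡ g 0 → f 1 ≡ g 1 → ∀ n → f n ≡ g n
fibonacciLike-unique rf rg f0 f1 0 = f0
fibonacciLike-unique rf rg f0 f1 1 = f1
fibonacciLike-unique {f} {g} rf rg f0 f1 (suc (suc n)) = begin
  f (2 + n)           ≡⟨ recurrence rf n ⟩
  f (1 + n) + f n     ≡⟨ cong₂ _+_ (fibonacciLike-unique rf rg f0 f1 (suc n)) (fibonacciLike-unique rf rg f0 f1 n) ⟩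
  g (1 + n) + g n     ≡⟨ recurrence rg n ⟨
  g (2 + n)           ∎
  where open ≡-Reasoning

L+F≡2*F[1+n] : ∀ n → L n + F n ≡ 2 * F (suc n)
L+F≡2*F[1+n] = fibonacciLike-unique
  (+-fibonacciLike L-fibonacciLike F-fibonacciLike)
  (*ˡ-fibonacciLike 2 (suc-fibonacciLike F-fibonacciLike)) refl refl

2*L[1+n]≡L+5*F : ∀ n → 2 * L (suc n) ≡ L n + 5 * F n
2*L[1+n]≡L+5*F = fibonacciLike-unique
  (*ˡ-fibonacciLike 2 (suc-fibonacciLike L-fibonacciLike))
  (+-fibonacciLike L-fibonacciLike (*ˡ-fibonacciLike 5 F-fibonacciLike)) refl refl

2*L[m+n]≡L*L+5*F*F : ∀ m n → 2 * L (m + n) ≡ L m * L n + 5 * F m * F n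
2*L[m+n]≡L*L+5*F*F m n = fibonacciLike-unique
  (*ˡ-fibonacciLike 2 (+ʳ-fibonacciLike n L-fibonacciLike))
  (+-fibonacciLike (*ʳ-fibonacciLike (L n) L-fibonacciLike)
                   (*ʳ-fibonacciLike (F n) (*ˡ-fibonacciLike 5 F-fibonacciLike)))
  (at0 (L n) (F n)) (trans (2*L[1+n]≡L+5*F n) (at1 (L n) (F n))) m
  where
  at0 : ∀ a b → 2 * a ≡ 2 * a + 5 * 0 * b
  at0 = solve-∀
  at1 : ∀ a b → a + 5 * b ≡ 1 * a + 5 * 1 * b
  at1 = solve-∀

-- Unlike 2 * n, double (suc n) reduces to suc (suc (double n)), so F and L unfold along even indices.
double : ℕ → ℕ
double zero = zero
double (suc n) = suc (suc (double n))

double≡2* : ∀ n → double n ≡ 2 * n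
double≡2* zero = refl
double≡2* (suc n) = trans (cong (2 +_) (double≡2* n)) (sym (*-distribˡ-+ 2 1 n))

F[1+n]≥1 : ∀ n → 1 ≤ F (suc n)
F[1+n]≥1 zero = ≤-refl
F[1+n]≥1 (suc n) = ≤-trans (F[1+n]≥1 n) (m≤m+n _ _)

L-mono : ∀ k j → L (suc k) ≤ L (suc k + j)
L-mono k zero = ≤-reflexive (cong L (sym (+-identityʳ (suc k))))
L-mono k (suc j) = ≤-trans (L-mono k j)
  (≤-trans (m≤m+n (L (suc k + j)) (L (k + j))) (≤-reflexive (cong L (sym (+-suc (suc k) j)))))

L[2m]≥3 : ∀ {m} → 0 < m → 3 ≤ L (2 * m)
L[2m]≥3 {suc m} _ = subst (λ n → 3 ≤ L n) (double≡2* (suc m)) (L-mono 1 (double m))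

F[2m]≥1 : ∀ {m} → 0 < m → 1 ≤ F (2 * m)
F[2m]≥1 {suc m} _ = subst (λ n → 1 ≤ F n) (double≡2* (suc m)) (F[1+n]≥1 (suc (double m)))

-- Cassini's identity and its converse

Cassini⁺ Cassini⁻ : ℕ → ℕ → Set
Cassini⁺ u w = u * u ≡ u * w + w * w + 1
Cassini⁻ u w = u * u + 1 ≡ u * w + w * w

balance⁺ : ∀ {x y z v} → x + v ≡ y + z → (x ≡ y + 1 ⇔ v + 1 ≡ z)
balance⁺ {x} {y} {z} {v} e = mk⇔
  (λ x≡y+1 → +-cancelˡ-≡ y _ _ (trans (reorder y v) (trans (cong (_+ v) (sym x≡y+1)) e)))
  (λ v+1≡z → +-cancelʳ-≡ v _ _ (trans e (trans (cong (y +_) (sym v+1≡z)) (reorder y v))))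
  where
  reorder : ∀ y v → y + (v + 1) ≡ y + 1 + v
  reorder = solve-∀

balance⁻ : ∀ {x y z v} → x + v ≡ y + z → (x + 1 ≡ y ⇔ v ≡ z + 1)
balance⁻ {x} {y} {z} {v} e = mk⇔
  (λ x+1≡y → +-cancelˡ-≡ y _ _ (trans (cong (_+ v) (sym x+1≡y)) (trans (reorder₁ x v) (trans (cong (_+ 1) e) (reorder₂ y z)))))
  (λ v≡z+1 → +-cancelʳ-≡ z _ _ (trans (reorder₃ x z) (trans (cong (x +_) (sym v≡z+1)) e)))
  where
  reorder₁ : ∀ x v → x + 1 + v ≡ x + v + 1
  reorder₁ = solve-∀
  reorder₂ : ∀ y z → y + z + 1 ≡ y + (z + 1)
  reorder₂ = solve-∀
  reorder₃ : ∀ x z → x + 1 + z ≡ x + (z + 1)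
  reorder₃ = solve-∀

-- Both Cassini forms are read off this identity: the step (w , t) ↦ (w + t , w) swaps their signs.
sum-square-split : ∀ w t → (w + t) * (w + t) + w * w ≡ ((w + t) * w + w * w) + (w * t + t * t)
sum-square-split = solve-∀

cassini⁺-step : ∀ w t → Cassini⁺ (w + t) w ⇔ Cassini⁻ w t
cassini⁺-step w t = balance⁺ (sum-square-split w t)

cassini⁻-step : ∀ w t → Cassini⁻ (w + t) w ⇔ Cassini⁺ w t
cassini⁻-step w t = balance⁻ (sum-square-split w t)

F-cassini⁺ : ∀ i → Cassini⁺ (F (suc (double i))) (F (double i))
F-cassini⁻ : ∀ i → Cassini⁻ (F (2 + double i)) (F (1 + double i))
F-cassini⁺ zero = refl
F-cassini⁺ (suc i) = Equivalence.from (cassini⁺-step (F (2 + double i)) (F (1 + double i))) (F-cassini⁻ i)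
F-cassini⁻ i = Equivalence.from (cassini⁻-step (F (1 + double i)) (F (double i))) (F-cassini⁺ i)

cassini⁺-zero : ∀ u → Cassini⁺ u 0 → u ≡ 1
cassini⁺-zero u c = m*n≡1⇒m≡1 u u (trans c (cong (λ z → z + 0 + 1) (*-zeroʳ u)))

cassini⁻-zero : ∀ u → ¬ Cassini⁻ u 0
cassini⁻-zero u c with trans (+-comm 1 (u * u)) (trans c (cong (_+ 0) (*-zeroʳ u)))
... | ()

cassini⁺⇒≤ : ∀ {u w} → Cassini⁺ u w → w ≤ u
cassini⁺⇒≤ {u} {w} c = ≮⇒≥ λ u<w → <-irrefl c (begin-strict
  u * u                 ≤⟨ *-monoʳ-≤ u (<⇒≤ u<w) ⟩
  u * w                 ≤⟨ m≤m+n (u * w) (w * w) ⟩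
  u * w + w * w         <⟨ m<m+n _ z<s ⟩
  u * w + w * w + 1     ∎)
  where open ≤-Reasoning

cassini⁻⇒≤ : ∀ {u w} → 1 ≤ u → Cassini⁻ u w → w ≤ u
cassini⁻⇒≤ {u@(suc _)} {w} _ c = ≮⇒≥ λ u<w → <-irrefl c
  (+-mono-≤ (*-monoʳ-< u u<w) (*-mono-≤ (≤-trans z<s u<w) (≤-trans z<s u<w)))

cassini⁺-descent : ∀ {u w} → Acc _<_ u → Cassini⁺ u w →
                   Σ ℕ λ i → u ≡ F (suc (double i)) × w ≡ F (double i)
cassini⁻-descent : ∀ {u w} → Acc _<_ u → 1 ≤ u → Cassini⁻ u w →
                   Σ ℕ λ i → u ≡ F (2 + double i) × w ≡ F (1 + double i)
cassini⁺-descent {u} {zero} _ c = 0 , cassini⁺-zero u c , refl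
cassini⁺-descent {u} {w@(suc _)} (acc rec) c with m≤n⇒∃[o]m+o≡n {w} {u} (cassini⁺⇒≤ c)
... | zero , refl = ⊥-elim (cassini⁻-zero w (Equivalence.to (cassini⁺-step w 0) c))
... | t@(suc _) , refl with cassini⁻-descent (rec (m<m+n w z<s)) z<s (Equivalence.to (cassini⁺-step w t) c)
... | i , w≡ , t≡ = suc i , cong₂ _+_ w≡ t≡ , w≡
cassini⁻-descent {u} {zero} _ _ c = ⊥-elim (cassini⁻-zero u c)
cassini⁻-descent {u} {w@(suc _)} (acc rec) 1≤u c with m≤n⇒∃[o]m+o≡n {w} {u} (cassini⁻⇒≤ 1≤u c)
... | zero , refl = 0 , cong (_+ 0) w≡1 , w≡1
  where
  w≡1 : w ≡ 1
  w≡1 = cassini⁺-zero w (Equivalence.to (cassini⁻-step w 0) c)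
... | t@(suc _) , refl with cassini⁺-descent (rec (m<m+n w z<s)) (Equivalence.to (cassini⁻-step w t) c)
... | i , w≡ , t≡ = i , cong₂ _+_ w≡ t≡ , w≡

-- Divisibility of squares

prime∣n*n⇒∣n : ∀ {p n} → Prime p → p ∣ n * n → p ∣ n
prime∣n*n⇒∣n {n = n} pp p∣n*n = reduce (euclidsLemma n n pp p∣n*n)

-- After dividing by g = gcd m n, the coprime m / g divides (n / g)², hence m / g = 1.
m*m∣n*n⇒m∣n : ∀ {m n} → m * m ∣ n * n → m ∣ n
m*m∣n*n⇒m∣n {zero} {n} 0∣n*n with m*n≡0⇒m≡0∨n≡0 n (0∣⇒≡0 0∣n*n)
... | inj₁ refl = ∣-refl
... | inj₂ refl = ∣-refl
m*m∣n*n⇒m∣n {m@(suc _)} {n} mm∣nn = subst (_∣ n) (sym m≡g) (gcd[m,n]∣n m n)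
  where
  g m′ n′ : ℕ
  g = gcd m n
  instance
    g≢0 : NonZero g
    g≢0 = ≢-nonZero (gcd[m,n]≢0 m n (inj₁ λ ()))
  m′ = m / g
  n′ = n / g
  m≡m′*g : m ≡ m′ * g
  m≡m′*g = sym (m/n*n≡m (gcd[m,n]∣m m n))
  n≡n′*g : n ≡ n′ * g
  n≡n′*g = sym (m/n*n≡m (gcd[m,n]∣n m n))
  square-* : ∀ a b → (a * b) * (a * b) ≡ (a * a) * (b * b)
  square-* = solve-∀
  m′m′∣n′n′ : m′ * m′ ∣ n′ * n′
  m′m′∣n′n′ = *-cancelʳ-∣ (g * g) {{m*n≢0 g g}} (subst₂ _∣_
    (trans (cong (λ s → s * s) m≡m′*g) (square-* m′ g))
    (trans (cong (λ s → s * s) n≡n′*g) (square-* n′ g)) mm∣nn)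
  m′≡1 : m′ ≡ 1
  m′≡1 = coprime-/gcd m n (∣-refl , coprime-divisor (coprime-/gcd m n) (∣-trans (m∣m*n m′) m′m′∣n′n′))
  m≡g : m ≡ g
  m≡g = trans m≡m′*g (trans (cong (_* g) m′≡1) (*-identityˡ g))

square-quotient : ∀ {W d c} → 1 ≤ W → d * d ≡ (W * W) * c → Σ ℕ λ e → d ≡ e * W × e * e ≡ c
square-quotient {W} {d} {c} 1≤W d²≡ =
  let divides e d≡e*W = m*m∣n*n⇒m∣n {W} {d} (divides c (trans d²≡ (*-comm (W * W) c)))
  in e , d≡e*W , *-cancelʳ-≡ (e * e) c (W * W) {{W²≢0}} (begin
    e * e * (W * W)       ≡⟨ square-* e W ⟨
    (e * W) * (e * W)     ≡⟨ cong (λ s → s * s) d≡e*W ⟨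
    d * d                 ≡⟨ d²≡ ⟩
    (W * W) * c           ≡⟨ *-comm (W * W) c ⟩
    c * (W * W)           ∎)
  where
  open ≡-Reasoning
  W²≢0 : NonZero (W * W)
  W²≢0 = m*n≢0 W W {{>-nonZero 1≤W}} {{>-nonZero 1≤W}}
  square-* : ∀ a b → (a * b) * (a * b) ≡ (a * a) * (b * b)
  square-* = solve-∀

prime-square-root : ∀ {p e c} → Prime p → e * e ≡ p * c → Σ ℕ λ f → e ≡ f * p × p * (f * f) ≡ c
prime-square-root {p} {e} {c} pp e²≡ =
  let divides f e≡f*p = prime∣n*n⇒∣n {n = e} pp (divides c (trans e²≡ (*-comm p c)))
  in f , e≡f*p , *-cancelˡ-≡ (p * (f * f)) c p {{prime⇒nonZero pp}} (begin
    p * (p * (f * f))     ≡⟨ square-* f p ⟩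
    (f * p) * (f * p)     ≡⟨ cong (λ s → s * s) e≡f*p ⟨
    e * e                 ≡⟨ e²≡ ⟩
    p * c                 ∎)
  where
  open ≡-Reasoning
  square-* : ∀ f p → p * (p * (f * f)) ≡ (f * p) * (f * p)
  square-* = solve-∀

prime≥2 : ∀ {p} → Prime p → 2 ≤ p
prime≥2 {2+ _} _ = s≤s (s≤s z≤n)

prime[5] : Prime 5
prime[5] = from-yes (prime? 5)

-- The equation x² + 4 = 5 f²

-- For a = 2 u − w this reads 4 (u² − u w − w²) = a² − 5 w².
halves-identity : ∀ a w u → a + w ≡ 2 * u → 4 * (u * u) + 5 * (w * w) ≡ a * a + 4 * (u * w + w * w)
halves-identity a w u a+w≡2u = begin
  4 * (u * u) + 5 * (w * w)           ≡⟨ expand u w ⟩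
  (2 * u) * (2 * u) + 5 * (w * w)     ≡⟨ cong (λ s → s * s + 5 * (w * w)) (sym a+w≡2u) ⟩
  (a + w) * (a + w) + 5 * (w * w)     ≡⟨ regroup a w ⟩
  a * a + (a + w) * (2 * w) + 4 * (w * w) ≡⟨ cong (λ s → a * a + s * (2 * w) + 4 * (w * w)) a+w≡2u ⟩
  a * a + (2 * u) * (2 * w) + 4 * (w * w) ≡⟨ collect a u w ⟩
  a * a + 4 * (u * w + w * w)         ∎
  where
  open ≡-Reasoning
  expand : ∀ u w → 4 * (u * u) + 5 * (w * w) ≡ (2 * u) * (2 * u) + 5 * (w * w)
  expand = solve-∀
  regroup : ∀ a w → (a + w) * (a + w) + 5 * (w * w) ≡ a * a + (a + w) * (2 * w) + 4 * (w * w)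
  regroup = solve-∀
  collect : ∀ a u w → a * a + (2 * u) * (2 * w) + 4 * (w * w) ≡ a * a + 4 * (u * w + w * w)
  collect = solve-∀

cassini⁺⇒square : ∀ {a w u} → a + w ≡ 2 * u → Cassini⁺ u w → a * a ≡ 5 * (w * w) + 4
cassini⁺⇒square {a} {w} {u} a+w≡2u c = +-cancelʳ-≡ (4 * (u * w + w * w)) _ _ (begin
  a * a + 4 * (u * w + w * w)          ≡⟨ halves-identity a w u a+w≡2u ⟨
  4 * (u * u) + 5 * (w * w)            ≡⟨ cong (λ s → 4 * s + 5 * (w * w)) c ⟩
  4 * (u * w + w * w + 1) + 5 * (w * w) ≡⟨ regroup (u * w + w * w) (w * w) ⟩
  5 * (w * w) + 4 + 4 * (u * w + w * w) ∎)
  where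
  open ≡-Reasoning
  regroup : ∀ s t → 4 * (s + 1) + 5 * t ≡ 5 * t + 4 + 4 * s
  regroup = solve-∀

square⇒cassini⁻ : ∀ {a w u} → a + w ≡ 2 * u → 5 * (w * w) ≡ a * a + 4 → Cassini⁻ u w
square⇒cassini⁻ {a} {w} {u} a+w≡2u h = *-cancelˡ-≡ _ _ 4 (+-cancelʳ-≡ (a * a) _ _ (begin
  4 * (u * u + 1) + a * a           ≡⟨ regroup (u * u) (a * a) ⟩
  4 * (u * u) + (a * a + 4)         ≡⟨ cong (4 * (u * u) +_) h ⟨
  4 * (u * u) + 5 * (w * w)         ≡⟨ halves-identity a w u a+w≡2u ⟩
  a * a + 4 * (u * w + w * w)       ≡⟨ +-comm (a * a) _ ⟩
  4 * (u * w + w * w) + a * a       ∎))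
  where
  open ≡-Reasoning
  regroup : ∀ s t → 4 * (s + 1) + t ≡ 4 * s + (t + 4)
  regroup = solve-∀

L[2m]²≡5F[2m]²+4 : ∀ m → L (2 * m) * L (2 * m) ≡ 5 * (F (2 * m) * F (2 * m)) + 4
L[2m]²≡5F[2m]²+4 m = subst (λ n → L n * L n ≡ 5 * (F n * F n) + 4) (double≡2* m)
  (cassini⁺⇒square {L (double m)} {F (double m)} {F (suc (double m))} (L+F≡2*F[1+n] (double m)) (F-cassini⁺ m))

pell⇒2∣sum : ∀ {x f} → 5 * (f * f) ≡ x * x + 4 → 2 ∣ x + f
pell⇒2∣sum {x} {f} h = prime∣n*n⇒∣n prime[2] 2∣[x+f]²
  where
  expand : ∀ x f → 4 * (f * f) + (x + f) * (x + f) ≡ x * x + 2 * (x * f) + 5 * (f * f)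
  expand = solve-∀
  halve : ∀ x f → x * x + 2 * (x * f) + (x * x + 4) ≡ (x * x + x * f + 2) * 2
  halve = solve-∀
  twice-double : ∀ s → 4 * s ≡ 2 * s * 2
  twice-double = solve-∀
  2∣[x+f]² : 2 ∣ (x + f) * (x + f)
  2∣[x+f]² = ∣m+n∣m⇒∣n
    (divides (x * x + x * f + 2) (trans (expand x f) (trans (cong (x * x + 2 * (x * f) +_) h) (halve x f))))
    (divides (2 * (f * f)) (twice-double (f * f)))

pell⇒odd-lucas : ∀ {x f} → 1 ≤ x → 5 * (f * f) ≡ x * x + 4 →
                 Σ ℕ λ i → x ≡ L (suc (double i)) × f ≡ F (suc (double i))
pell⇒odd-lucas {x} {f} 1≤x h with pell⇒2∣sum {x} {f} h
... | divides zero x+f≡0 = ⊥-elim (<-irrefl refl (≤-trans 1≤x (≤-trans (m≤m+n x f) (≤-reflexive x+f≡0))))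
... | divides u@(suc _) x+f≡u*2
  with cassini⁻-descent {u} {f} (<-wellFounded u) z<s (square⇒cassini⁻ {x} {f} {u} x+f≡2u h)
  where
  x+f≡2u : x + f ≡ 2 * u
  x+f≡2u = trans x+f≡u*2 (*-comm u 2)
... | i , u≡ , f≡ = i , +-cancelʳ-≡ f x (L r) x+f≡L+f , f≡
  where
  r : ℕ
  r = suc (double i)
  x+f≡L+f : x + f ≡ L r + f
  x+f≡L+f = begin
    x + f           ≡⟨ x+f≡u*2 ⟩
    u * 2           ≡⟨ *-comm u 2 ⟩
    2 * u           ≡⟨ cong (2 *_) u≡ ⟩
    2 * F (suc r)   ≡⟨ L+F≡2*F[1+n] r ⟨
    L r + F r       ≡⟨ cong (L r +_) f≡ ⟨
    L r + f         ∎
    where open ≡-Reasoning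

pell-root : ∀ {W x d} → 1 ≤ W → d * d ≡ (W * W) * (5 * (x * x + 4)) →
            Σ ℕ λ f → d ≡ f * 5 * W × 5 * (f * f) ≡ x * x + 4
pell-root {W} {x} {d} W≥1 d²≡ =
  let e , d≡eW , e²≡ = square-quotient {W} W≥1 d²≡
      f , e≡f5 , pell = prime-square-root {5} {e} prime[5] e²≡
  in f , trans d≡eW (cong (_* W) e≡f5) , pell

-- The equation x² + y² + 4 = A x y + A²

difference : ∀ a b → Σ ℕ λ d → a ≡ b + d ⊎ a + d ≡ b
difference a b with ≤-total b a
... | inj₁ b≤a = let d , b+d≡a = m≤n⇒∃[o]m+o≡n b≤a in d , inj₁ (sym b+d≡a)
... | inj₂ a≤b = let d , a+d≡b = m≤n⇒∃[o]m+o≡n a≤b in d , inj₂ a+d≡b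

difference-square : ∀ {a b d} → a ≡ b + d ⊎ a + d ≡ b → d * d + 2 * (a * b) ≡ a * a + b * b
difference-square {b = b} {d} (inj₁ refl) = expand b d
  where
  expand : ∀ b d → d * d + 2 * ((b + d) * b) ≡ (b + d) * (b + d) + b * b
  expand = solve-∀
difference-square {a} {d = d} (inj₂ refl) = expand a d
  where
  expand : ∀ a d → d * d + 2 * (a * (a + d)) ≡ a * a + (a + d) * (a + d)
  expand = solve-∀

-- d is the distance between 2y and Ax, i.e. the square root of the discriminant of the quadratic in y.
discriminant : ∀ {A x y d} → x * x + y * y + 4 ≡ A * x * y + A * A →
               (2 * y ≡ A * x + d ⊎ 2 * y + d ≡ A * x) →
               d * d + 4 * (x * x) + 16 ≡ A * A * (x * x) + 4 * (A * A)
discriminant {A} {x} {y} {d} eq branch = +-cancelʳ-≡ (4 * (A * x * y)) _ _ (begin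
  d * d + 4 * (x * x) + 16 + 4 * (A * x * y)                ≡⟨ regroup₁ A x y d ⟩
  (d * d + 2 * ((2 * y) * (A * x))) + 4 * (x * x) + 16     ≡⟨ cong (λ s → s + 4 * (x * x) + 16) (difference-square branch) ⟩
  (2 * y) * (2 * y) + (A * x) * (A * x) + 4 * (x * x) + 16 ≡⟨ regroup₂ A x y ⟩
  4 * (x * x + y * y + 4) + (A * x) * (A * x)              ≡⟨ cong (λ s → 4 * s + (A * x) * (A * x)) eq ⟩
  4 * (A * x * y + A * A) + (A * x) * (A * x)              ≡⟨ regroup₃ A x y ⟩
  A * A * (x * x) + 4 * (A * A) + 4 * (A * x * y)          ∎)
  where
  open ≡-Reasoning
  regroup₁ : ∀ A x y d → d * d + 4 * (x * x) + 16 + 4 * (A * x * y) ≡ (d * d + 2 * ((2 * y) * (A * x))) + 4 * (x * x) + 16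
  regroup₁ = solve-∀
  regroup₂ : ∀ A x y → (2 * y) * (2 * y) + (A * x) * (A * x) + 4 * (x * x) + 16 ≡ 4 * (x * x + y * y + 4) + (A * x) * (A * x)
  regroup₂ = solve-∀
  regroup₃ : ∀ A x y → 4 * (A * x * y + A * A) + (A * x) * (A * x) ≡ A * A * (x * x) + 4 * (A * A) + 4 * (A * x * y)
  regroup₃ = solve-∀

discriminant-pell : ∀ {A W x d} → A * A ≡ 5 * (W * W) + 4 →
                    d * d + 4 * (x * x) + 16 ≡ A * A * (x * x) + 4 * (A * A) →
                    d * d ≡ (W * W) * (5 * (x * x + 4))
discriminant-pell {A} {W} {x} {d} A²≡ disc = +-cancelʳ-≡ (4 * (x * x) + 16) _ _ (begin
  d * d + (4 * (x * x) + 16)                             ≡⟨ +-assoc (d * d) _ 16 ⟨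
  d * d + 4 * (x * x) + 16                               ≡⟨ disc ⟩
  A * A * (x * x) + 4 * (A * A)                          ≡⟨ cong (λ s → s * (x * x) + 4 * s) A²≡ ⟩
  (5 * (W * W) + 4) * (x * x) + 4 * (5 * (W * W) + 4)   ≡⟨ regroup W x ⟩
  (W * W) * (5 * (x * x + 4)) + (4 * (x * x) + 16)      ∎)
  where
  open ≡-Reasoning
  regroup : ∀ W x → (5 * (W * W) + 4) * (x * x) + 4 * (5 * (W * W) + 4) ≡ (W * W) * (5 * (x * x + 4)) + (4 * (x * x) + 16)
  regroup = solve-∀

vieta-product : ∀ {A x y y′} → y + y′ ≡ A * x → x * x + y * y + 4 ≡ A * x * y + A * A →
                y * y′ + A * A ≡ x * x + 4
vieta-product {A} {x} {y} {y′} y+y′≡Ax eq = sym (+-cancelʳ-≡ (y * y) _ _ (begin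
  x * x + 4 + y * y       ≡⟨ +-assoc (x * x) 4 (y * y) ⟩
  x * x + (4 + y * y)     ≡⟨ cong (x * x +_) (+-comm 4 (y * y)) ⟩
  x * x + (y * y + 4)     ≡⟨ +-assoc (x * x) (y * y) 4 ⟨
  x * x + y * y + 4       ≡⟨ eq ⟩
  A * x * y + A * A       ≡⟨ cong (λ s → s * y + A * A) y+y′≡Ax ⟨
  (y + y′) * y + A * A    ≡⟨ regroup y y′ (A * A) ⟩
  y * y′ + A * A + y * y  ∎))
  where
  open ≡-Reasoning
  regroup : ∀ y y′ c → (y + y′) * y + c ≡ y * y′ + c + y * y
  regroup = solve-∀

9≰4 : ¬ 9 ≤ 4
9≰4 (s≤s (s≤s (s≤s (s≤s ()))))

-- The roots in y are (A x ± d) / 2, with product x² + 4 − A² < x², so they cannot both be ≥ x.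
larger-root : ∀ {A x y y⋆ d} → 3 ≤ A → x < y → x ≤ y⋆ → x * x + y * y + 4 ≡ A * x * y + A * A →
              2 * y⋆ ≡ A * x + d → (2 * y ≡ A * x + d ⊎ 2 * y + d ≡ A * x) → y ≡ y⋆
larger-root {y = y} {y⋆} _ _ _ _ 2y⋆≡ (inj₁ 2y≡) = *-cancelˡ-≡ y y⋆ 2 (trans 2y≡ (sym 2y⋆≡))
larger-root {A} {x} {y} {y⋆} {d} 3≤A x<y x≤y⋆ eq 2y⋆≡ (inj₂ 2y+d≡) = ⊥-elim (9≰4 (+-cancelˡ-≤ (x * x) 9 4 (begin
  x * x + 9           ≤⟨ +-mono-≤ (*-mono-≤ (<⇒≤ x<y) x≤y⋆) (*-mono-≤ 3≤A 3≤A) ⟩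
  y * y⋆ + A * A      ≡⟨ vieta-product {A} {x} {y} {y⋆} y+y⋆≡Ax eq ⟩
  x * x + 4           ∎)))
  where
  open ≤-Reasoning
  regroup : ∀ a b c → a + (b + c) ≡ (a + c) + b
  regroup = solve-∀
  y+y⋆≡Ax : y + y⋆ ≡ A * x
  y+y⋆≡Ax = *-cancelˡ-≡ _ _ 2 (begin-equality
    2 * (y + y⋆)          ≡⟨ *-distribˡ-+ 2 y y⋆ ⟩
    2 * y + 2 * y⋆        ≡⟨ cong (2 * y +_) 2y⋆≡ ⟩
    2 * y + (A * x + d)   ≡⟨ regroup (2 * y) (A * x) d ⟩
    (2 * y + d) + A * x   ≡⟨ cong (_+ A * x) 2y+d≡ ⟩
    A * x + A * x         ≡⟨ cong (A * x +_) (+-identityʳ (A * x)) ⟨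
    2 * (A * x)           ∎)

2*L[r+n]≡L[n]*x+d : ∀ {r n x f d} → x ≡ L r → f ≡ F r → d ≡ f * 5 * F n → 2 * L (r + n) ≡ L n * x + d
2*L[r+n]≡L[n]*x+d {r} {n} {x} {f} {d} x≡L f≡F d≡f*5*F = begin
  2 * L (r + n)                  ≡⟨ 2*L[m+n]≡L*L+5*F*F r n ⟩
  L r * L n + 5 * F r * F n      ≡⟨ regroup (L r) (L n) (F r) (F n) ⟩
  L n * L r + F r * 5 * F n      ≡⟨ cong₂ (λ a b → L n * a + b * 5 * F n) x≡L f≡F ⟨
  L n * x + f * 5 * F n          ≡⟨ cong (L n * x +_) d≡f*5*F ⟨
  L n * x + d                    ∎
  where
  open ≡-Reasoning
  regroup : ∀ a A b W → a * A + 5 * b * W ≡ A * a + b * 5 * W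
  regroup = solve-∀

lucas-root : ∀ {m x y d} → 0 < m → 1 ≤ x →
             x * x + y * y + 4 ≡ L (2 * m) * x * y + L (2 * m) * L (2 * m) →
             (2 * y ≡ L (2 * m) * x + d ⊎ 2 * y + d ≡ L (2 * m) * x) →
             Σ ℕ λ i → x ≡ L (suc (double i)) × 2 * L (suc (double i) + 2 * m) ≡ L (2 * m) * x + d
lucas-root {m} {x} {y} {d} 0<m 1≤x eq branch =
  let f , d≡f*5*W , pell = pell-root {F (2 * m)} {x} {d} (F[2m]≥1 0<m) d²
      i , x≡L , f≡F = pell⇒odd-lucas {x} {f} 1≤x pell
  in i , x≡L , 2*L[r+n]≡L[n]*x+d {suc (double i)} {2 * m} {x} {f} {d} x≡L f≡F d≡f*5*W
  where
  d² : d * d ≡ (F (2 * m) * F (2 * m)) * (5 * (x * x + 4))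
  d² = discriminant-pell {L (2 * m)} {F (2 * m)} {x} {d} (L[2m]²≡5F[2m]²+4 m)
         (discriminant {L (2 * m)} {x} {y} {d} eq branch)

lucas-solutions : ∀ {m x y} → 0 < m → 1 ≤ x → x < y →
                  x * x + y * y + 4 ≡ L (2 * m) * x * y + L (2 * m) * L (2 * m) →
                  Σ ℕ λ k → 0 < k × x ≡ L (2 * k ∸ 1) × y ≡ L (2 * k + 2 * m ∸ 1)
lucas-solutions {m} {x} {y} 0<m 1≤x x<y eq =
  let d , branch = difference (2 * y) (L (2 * m) * x)
      i , x≡L , 2*L[r+2m]≡ = lucas-root {m} {x} {y} {d} 0<m 1≤x eq branch
      x≤L[r+2m] : x ≤ L (suc (double i) + 2 * m)
      x≤L[r+2m] = subst (_≤ L (suc (double i) + 2 * m)) (sym x≡L) (L-mono (double i) (2 * m))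
      y≡L : y ≡ L (suc (double i) + 2 * m)
      y≡L = larger-root {L (2 * m)} {x} {y} {L (suc (double i) + 2 * m)} {d} (L[2m]≥3 0<m) x<y x≤L[r+2m] eq 2*L[r+2m]≡ branch
  in suc i , z<s ,
     trans x≡L (cong (λ n → L (n ∸ 1)) (double≡2* (suc i))) ,
     trans y≡L (cong (λ n → L (n + 2 * m ∸ 1)) (double≡2* (suc i)))

-- Sums of squares of divisors

n^2≡n*n : ∀ n → n ^ 2 ≡ n * n
n^2≡n*n n = cong (n *_) (*-identityʳ n)

-- The sum of d² over the divisors d ≤ N of n; σ₂ n is σ₂≤ n n by definition.
σ₂≤ : ℕ → ℕ → ℕ
σ₂≤ n N = sum (map (λ d → d ^ 2) (filter (_∣? n) (map suc (upTo N))))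

σ₂≤-suc : ∀ n N → σ₂≤ n (suc N) ≡ σ₂≤ n N + sum (map (λ d → d ^ 2) (filter (_∣? n) (suc N ∷ [])))
σ₂≤-suc n N = begin
  sum (map sq (filter (_∣? n) (map suc (upTo (suc N)))))
    ≡⟨ cong (λ ds → sum (map sq (filter (_∣? n) (map suc ds)))) (upTo-∷ʳ N) ⟨
  sum (map sq (filter (_∣? n) (map suc (upTo N ++ N ∷ []))))
    ≡⟨ cong (λ ds → sum (map sq (filter (_∣? n) ds))) (map-++ suc (upTo N) (N ∷ [])) ⟩
  sum (map sq (filter (_∣? n) (map suc (upTo N) ++ suc N ∷ [])))
    ≡⟨ cong (λ ds → sum (map sq ds)) (filter-++ (_∣? n) (map suc (upTo N)) (suc N ∷ [])) ⟩
  sum (map sq (filter (_∣? n) (map suc (upTo N)) ++ filter (_∣? n) (suc N ∷ [])))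
    ≡⟨ cong sum (map-++ sq (filter (_∣? n) (map suc (upTo N))) (filter (_∣? n) (suc N ∷ []))) ⟩
  sum (map sq (filter (_∣? n) (map suc (upTo N))) ++ map sq (filter (_∣? n) (suc N ∷ [])))
    ≡⟨ sum-++ (map sq (filter (_∣? n) (map suc (upTo N)))) _ ⟩
  σ₂≤ n N + sum (map sq (filter (_∣? n) (suc N ∷ [])))
    ∎
  where
  open ≡-Reasoning
  sq : ℕ → ℕ
  sq d = d ^ 2

σ₂≤-∣ : ∀ {n d} → suc d ∣ n → σ₂≤ n (suc d) ≡ σ₂≤ n d + suc d * suc d
σ₂≤-∣ {n} {d} d∣n = trans (σ₂≤-suc n d)
  (trans (cong (λ ds → σ₂≤ n d + sum (map (λ d → d ^ 2) ds)) (filter-accept (_∣? n) d∣n))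
         (cong (σ₂≤ n d +_) (trans (+-identityʳ _) (n^2≡n*n (suc d)))))

σ₂≤-∤ : ∀ {n d} → suc d ∤ n → σ₂≤ n (suc d) ≡ σ₂≤ n d
σ₂≤-∤ {n} {d} d∤n = trans (σ₂≤-suc n d)
  (trans (cong (λ ds → σ₂≤ n d + sum (map (λ d → d ^ 2) ds)) (filter-reject (_∣? n) d∤n)) (+-identityʳ _))

σ₂≤-1 : ∀ n → σ₂≤ n 1 ≡ 1
σ₂≤-1 n = σ₂≤-∣ (1∣ n)

σ₂≤-mono : ∀ n {a b} → a ≤ b → σ₂≤ n a ≤ σ₂≤ n b
σ₂≤-mono n {zero} {zero} z≤n = ≤-refl
σ₂≤-mono n {a} {suc b} a≤1+b with m≤n⇒m<n∨m≡n a≤1+b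
... | inj₂ refl = ≤-refl
... | inj₁ (s≤s a≤b) with suc b ∣? n
...   | yes d∣n = ≤-trans (σ₂≤-mono n a≤b) (≤-trans (m≤m+n _ _) (≤-reflexive (sym (σ₂≤-∣ d∣n))))
...   | no d∤n = ≤-trans (σ₂≤-mono n a≤b) (≤-reflexive (sym (σ₂≤-∤ d∤n)))

NoDivisorBetween : ℕ → ℕ → ℕ → Set
NoDivisorBetween n c d = ∀ e → c < e → e < d → e ∤ n

σ₂≤-gap : ∀ {n c d} → c ≤ d → NoDivisorBetween n c (suc d) → σ₂≤ n d ≡ σ₂≤ n c
σ₂≤-gap {n} {c} {zero} z≤n _ = refl
σ₂≤-gap {n} {c} {suc d} c≤1+d gap with m≤n⇒m<n∨m≡n c≤1+d
... | inj₂ refl = refl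
... | inj₁ (s≤s c≤d) = trans (σ₂≤-∤ (gap (suc d) (s≤s c≤d) ≤-refl))
                             (σ₂≤-gap c≤d λ e c<e e<1+d → gap e c<e (m<n⇒m<1+n e<1+d))

σ₂≤-next : ∀ {n c d} → c < d → d ∣ n → NoDivisorBetween n c d → σ₂≤ n d ≡ σ₂≤ n c + d * d
σ₂≤-next {d = suc d} (s≤s c≤d) d∣n gap = trans (σ₂≤-∣ d∣n) (cong (_+ suc d * suc d) (σ₂≤-gap c≤d gap))

no-divisor-between : ∀ {n c d ds} → (∀ {e} → e ∣ n → e ∈ ds) → All (λ e → e ≤ c ⊎ d ≤ e) ds →
                     NoDivisorBetween n c d
no-divisor-between divisors outside e c<e e<d e∣n with All.lookup outside (divisors e∣n)
... | inj₁ e≤c = <-irrefl refl (<-≤-trans c<e e≤c)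
... | inj₂ d≤e = <-irrefl refl (<-≤-trans e<d d≤e)

∣prime⇒∈ : ∀ {p d} → Prime p → d ∣ p → d ∈ 1 ∷ p ∷ []
∣prime⇒∈ pp d∣p with prime⇒irreducible pp d∣p
... | inj₁ d≡1 = here d≡1
... | inj₂ d≡p = there (here d≡p)

∣p*q⇒∈ : ∀ {p q d} → Prime p → Prime q → d ∣ p * q → d ∈ 1 ∷ p ∷ q ∷ p * q ∷ []
∣p*q⇒∈ {p} {q} {d} pp pq d∣pq with p ∣? d
... | yes (divides e d≡e*p) with prime⇒irreducible pq {e} (*-cancelʳ-∣ {e} {q} p {{prime⇒nonZero pp}} e*p∣q*p)
  where
  e*p∣q*p : e * p ∣ q * p
  e*p∣q*p = subst₂ _∣_ d≡e*p (*-comm p q) d∣pq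
...   | inj₁ e≡1 = there (here (trans d≡e*p (trans (cong (_* p) e≡1) (*-identityˡ p))))
...   | inj₂ e≡q = there (there (there (here (trans d≡e*p (trans (cong (_* p) e≡q) (*-comm q p))))))
∣p*q⇒∈ {p} {q} {d} pp pq d∣pq | no p∤d with prime⇒irreducible pq (coprime-divisor d⊥p d∣pq)
  where
  d⊥p : Coprime d p
  d⊥p (i∣d , i∣p) with prime⇒irreducible pp i∣p
  ... | inj₁ i≡1 = i≡1
  ... | inj₂ refl = ⊥-elim (p∤d i∣d)
... | inj₁ d≡1 = here d≡1
... | inj₂ d≡q = there (there (here d≡q))

σ₂-prime : ∀ {p} → Prime p → σ₂ p ≡ 1 + p * p
σ₂-prime {p} pp = begin
  σ₂≤ p p
    ≡⟨ σ₂≤-next (prime≥2 pp) ∣-refl (no-divisor-between (∣prime⇒∈ pp) (inj₁ ≤-refl ∷ inj₂ ≤-refl ∷ [])) ⟩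
  σ₂≤ p 1 + p * p
    ≡⟨ cong (_+ p * p) (σ₂≤-1 p) ⟩
  1 + p * p
    ∎
  where open ≡-Reasoning

σ₂[p*p] : ∀ {p} → Prime p → σ₂ (p * p) ≡ 1 + p * p + (p * p) * (p * p)
σ₂[p*p] {p} pp = begin
  σ₂≤ n n
    ≡⟨ σ₂≤-next p<n (∣-refl {n}) (gap (inj₁ 1≤p ∷ inj₁ ≤-refl ∷ inj₁ ≤-refl ∷ inj₂ ≤-refl ∷ [])) ⟩
  σ₂≤ n p + n * n
    ≡⟨ cong (_+ n * n) (σ₂≤-next (prime≥2 pp) (m∣m*n p)
         (gap (inj₁ ≤-refl ∷ inj₂ ≤-refl ∷ inj₂ ≤-refl ∷ inj₂ p≤n ∷ []))) ⟩
  σ₂≤ n 1 + p * p + n * n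
    ≡⟨ cong (λ s → s + p * p + n * n) (σ₂≤-1 n) ⟩
  1 + p * p + n * n
    ∎
  where
  open ≡-Reasoning
  n : ℕ
  n = p * p
  p<n : p < n
  p<n = m<m*n p p {{prime⇒nonZero pp}} (prime≥2 pp)
  p≤n : p ≤ n
  p≤n = <⇒≤ p<n
  1≤p : 1 ≤ p
  1≤p = ≤-trans (s≤s z≤n) (prime≥2 pp)
  gap : ∀ {c d} → All (λ e → e ≤ c ⊎ d ≤ e) (1 ∷ p ∷ p ∷ n ∷ []) → NoDivisorBetween n c d
  gap = no-divisor-between (∣p*q⇒∈ pp pp)

σ₂[p*q] : ∀ {p q} → Prime p → Prime q → p < q → σ₂ (p * q) ≡ 1 + p * p + q * q + (p * q) * (p * q)
σ₂[p*q] {p} {q} pp pq p<q = begin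
  σ₂≤ n n
    ≡⟨ σ₂≤-next q<n (∣-refl {n}) (gap (inj₁ 1≤q ∷ inj₁ (<⇒≤ p<q) ∷ inj₁ ≤-refl ∷ inj₂ ≤-refl ∷ [])) ⟩
  σ₂≤ n q + n * n
    ≡⟨ cong (_+ n * n) (σ₂≤-next p<q (n∣m*n p)
         (gap (inj₁ 1≤p ∷ inj₁ ≤-refl ∷ inj₂ ≤-refl ∷ inj₂ (<⇒≤ q<n) ∷ []))) ⟩
  σ₂≤ n p + q * q + n * n
    ≡⟨ cong (λ s → s + q * q + n * n) (σ₂≤-next (prime≥2 pp) (m∣m*n q)
         (gap (inj₁ ≤-refl ∷ inj₂ ≤-refl ∷ inj₂ (<⇒≤ p<q) ∷ inj₂ (<⇒≤ (<-trans p<q q<n)) ∷ []))) ⟩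
  σ₂≤ n 1 + p * p + q * q + n * n
    ≡⟨ cong (λ s → s + p * p + q * q + n * n) (σ₂≤-1 n) ⟩
  1 + p * p + q * q + n * n
    ∎
  where
  open ≡-Reasoning
  n : ℕ
  n = p * q
  q<n : q < n
  q<n = subst (q <_) (*-comm q p) (m<m*n q p {{prime⇒nonZero pq}} (prime≥2 pp))
  1≤p : 1 ≤ p
  1≤p = ≤-trans (s≤s z≤n) (prime≥2 pp)
  1≤q : 1 ≤ q
  1≤q = ≤-trans 1≤p (<⇒≤ p<q)
  gap : ∀ {c d} → All (λ e → e ≤ c ⊎ d ≤ e) (1 ∷ p ∷ q ∷ n ∷ []) → NoDivisorBetween n c d
  gap = no-divisor-between (∣p*q⇒∈ pp pq)

σ₂-lower : ∀ {n t} → 1 < t → t < n → t ∣ n → 1 + t * t + n * n ≤ σ₂ n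
σ₂-lower {n@(suc n′)} {t@(suc t′)} (s≤s 1≤t′) (s≤s t≤n′) t∣n = begin
  1 + t * t + n * n              ≡⟨ cong (λ s → s + t * t + n * n) (σ₂≤-1 n) ⟨
  σ₂≤ n 1 + t * t + n * n        ≤⟨ +-monoˡ-≤ (n * n) (+-monoˡ-≤ (t * t) (σ₂≤-mono n 1≤t′)) ⟩
  σ₂≤ n t′ + t * t + n * n       ≡⟨ cong (_+ n * n) (σ₂≤-∣ t∣n) ⟨
  σ₂≤ n t + n * n                ≤⟨ +-monoˡ-≤ (n * n) (σ₂≤-mono n t≤n′) ⟩
  σ₂≤ n n′ + n * n               ≡⟨ σ₂≤-∣ (∣-refl {n}) ⟨
  σ₂ n                           ∎
  where open ≤-Reasoning

-- The least prime factor

least-divisor : ∀ n → 2 ≤ n → Σ ℕ λ p → 2 ≤ p × p ∣ n × p Rough n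
least-divisor n 2≤n = let k , 2+k≡n = m≤n⇒∃[o]m+o≡n 2≤n in search k 2 2+k≡n ≤-refl 2-rough
  where
  search : ∀ k m → m + k ≡ n → 2 ≤ m → m Rough n → Σ ℕ λ p → 2 ≤ p × p ∣ n × p Rough n
  search k m m+k≡n 2≤m rough with m ∣? n
  ... | yes m∣n = m , 2≤m , m∣n , rough
  search zero m m+0≡n 2≤m rough | no m∤n = ⊥-elim (m∤n (∣-reflexive (trans (sym (+-identityʳ m)) m+0≡n)))
  search (suc k) m m+1+k≡n 2≤m rough | no m∤n =
    search k (suc m) (trans (sym (+-suc m k)) m+1+k≡n) (≤-trans 2≤m (n≤1+n m)) (∤⇒rough-suc m∤n rough)

rough⇒≤-divisor : ∀ {p n d} → p Rough n → 2 ≤ d → d ∣ n → p ≤ d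
rough⇒≤-divisor rough 2≤d d∣n = rough⇒≤ {{n>1⇒nonTrivial 2≤d}} (rough∧∣⇒rough rough d∣n)

-- Cases of n = p t with p the least prime factor of n; when t is composite, p² ≤ t.
data Shape (n : ℕ) : Set where
  isPrime       : Prime n → Shape n
  primeSquare   : ∀ {p} → Prime p → n ≡ p * p → Shape n
  semiprime     : ∀ {p q} → Prime p → Prime q → p < q → n ≡ p * q → Shape n
  largeCofactor : ∀ {p t} → 2 ≤ p → p * p ≤ t → n ≡ p * t → Shape n

shape : ∀ n → 2 ≤ n → Shape n
shape n 2≤n with least-divisor n 2≤n
... | p , 2≤p , divides t n≡t*p , rough = by-cofactor t (trans n≡t*p (*-comm t p))
  where
  instance
    p-nonTrivial : NonTrivial p
    p-nonTrivial = n>1⇒nonTrivial 2≤p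
  prime-p : Prime p
  prime-p = rough∧∣⇒prime rough (divides t n≡t*p)
  by-cofactor : ∀ t → n ≡ p * t → Shape n
  by-cofactor zero n≡0 = ⊥-elim (n≮0 (≤-trans 2≤n (≤-reflexive (trans n≡0 (*-zeroʳ p)))))
  by-cofactor 1 n≡p = isPrime (subst Prime (sym (trans n≡p (*-identityʳ p))) prime-p)
  by-cofactor t@(2+ _) n≡p*t with prime? t
  ... | yes prime-t with m≤n⇒m<n∨m≡n {p} {t} (rough⇒≤-divisor {p} {n} {t} rough (s≤s (s≤s z≤n)) (divides p n≡p*t))
  ...   | inj₁ p<t = semiprime prime-p prime-t p<t n≡p*t
  ...   | inj₂ refl = primeSquare prime-p n≡p*t
  by-cofactor t@(2+ _) n≡p*t | no ¬prime-t with ¬prime⇒composite ¬prime-t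
  ... | hasNonTrivialDivisor {e} e<t (divides s t≡s*e) =
    largeCofactor 2≤p (≤-trans (*-mono-≤ p≤s p≤e) (≤-reflexive (sym t≡s*e))) n≡p*t
    where
    t∣n : t ∣ n
    t∣n = divides p n≡p*t
    p≤e : p ≤ e
    p≤e = rough⇒≤-divisor rough (nonTrivial⇒n>1 e) (∣-trans (divides s t≡s*e) t∣n)
    p≤s : p ≤ s
    p≤s = rough⇒≤-divisor rough (quotient>1 (divides s t≡s*e) e<t) (∣-trans (divides e (trans t≡s*e (*-comm s e))) t∣n)

-- Reduction to a product of two primes

cofactor-bound : ∀ {B n p t} → t * t < B * n → p * p ≤ t → n ≡ p * t → n < B * B * B
cofactor-bound {B} {n} {p} {t} t²<Bn p²≤t n≡pt = *-cancelʳ-< (n * n * n) n (B * B * B) (begin-strict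
  n * (n * n * n)                 ≡⟨ regroup₁ n ⟩
  (n * n) * (n * n)               ≤⟨ *-mono-≤ n²≤t³ n²≤t³ ⟩
  (t * t * t) * (t * t * t)       ≡⟨ regroup₂ t ⟩
  (t * t) * (t * t) * (t * t)     <⟨ *-mono-< (*-mono-< t²<Bn t²<Bn) t²<Bn ⟩
  (B * n) * (B * n) * (B * n)     ≡⟨ regroup₃ B n ⟩
  B * B * B * (n * n * n)         ∎)
  where
  open ≤-Reasoning
  regroup₁ : ∀ n → n * (n * n * n) ≡ (n * n) * (n * n)
  regroup₁ = solve-∀
  regroup₂ : ∀ t → (t * t * t) * (t * t * t) ≡ (t * t) * (t * t) * (t * t)
  regroup₂ = solve-∀
  regroup₃ : ∀ B n → (B * n) * (B * n) * (B * n) ≡ B * B * B * (n * n * n)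
  regroup₃ = solve-∀
  regroup₄ : ∀ p t → (p * t) * (p * t) ≡ t * t * (p * p)
  regroup₄ = solve-∀
  n²≤t³ : n * n ≤ t * t * t
  n²≤t³ = begin
    n * n             ≡⟨ cong (λ s → s * s) n≡pt ⟩
    (p * t) * (p * t) ≡⟨ regroup₄ p t ⟩
    t * t * (p * p)   ≤⟨ *-monoʳ-≤ (t * t) p²≤t ⟩
    t * t * t         ∎

-- σ₂ n = n² + A n + A² − 3, with the subtraction moved to the left.
σ₂-Equation : ℕ → ℕ → Set
σ₂-Equation A n = σ₂ n + 3 ≡ n * n + A * n + A * A

σ₂-excess : ∀ {A n s} → σ₂ n ≡ s + n * n → σ₂-Equation A n → s + 3 ≡ A * n + A * A
σ₂-excess {A} {n} {s} σ₂≡ eq = +-cancelʳ-≡ (n * n) _ _ (begin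
  s + 3 + n * n          ≡⟨ regroup₁ s (n * n) ⟩
  s + n * n + 3          ≡⟨ cong (_+ 3) σ₂≡ ⟨
  σ₂ n + 3               ≡⟨ eq ⟩
  n * n + A * n + A * A  ≡⟨ regroup₂ (n * n) (A * n) (A * A) ⟩
  A * n + A * A + n * n  ∎)
  where
  open ≡-Reasoning
  regroup₁ : ∀ s m → s + 3 + m ≡ s + m + 3
  regroup₁ = solve-∀
  regroup₂ : ∀ a b c → a + b + c ≡ b + c + a
  regroup₂ = solve-∀

σ₂-excess-≤ : ∀ {A n s} → s + n * n ≤ σ₂ n → σ₂-Equation A n → s + 3 ≤ A * n + A * A
σ₂-excess-≤ {A} {n} {s} σ₂≥ eq = +-cancelʳ-≤ (n * n) _ _ (begin
  s + 3 + n * n           ≡⟨ regroup₁ s (n * n) ⟩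
  s + n * n + 3           ≤⟨ +-monoˡ-≤ 3 σ₂≥ ⟩
  σ₂ n + 3                ≡⟨ eq ⟩
  n * n + A * n + A * A   ≡⟨ regroup₂ (n * n) (A * n) (A * A) ⟩
  A * n + A * A + n * n   ∎)
  where
  open ≤-Reasoning
  regroup₁ : ∀ s m → s + 3 + m ≡ s + m + 3
  regroup₁ = solve-∀
  regroup₂ : ∀ a b c → a + b + c ≡ b + c + a
  regroup₂ = solve-∀

prime-no-solution : ∀ {A n} → 3 ≤ A → σ₂-Equation A n → ¬ Prime n
prime-no-solution {A} {n} 3≤A eq prime-n = 9≰4 (begin
  9              ≤⟨ *-mono-≤ 3≤A 3≤A ⟩
  A * A          ≤⟨ m≤n+m (A * A) (A * n) ⟩
  A * n + A * A  ≡⟨ σ₂-excess {A} {n} {1} (σ₂-prime prime-n) eq ⟨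
  4              ∎)
  where open ≤-Reasoning

prime-square-no-solution : ∀ {A p} → 3 ≤ A → σ₂-Equation A (p * p) → ¬ Prime p
prime-square-no-solution {A} {p} 3≤A eq prime-p = 9≰4 (+-cancelˡ-≤ n 9 4 (begin
  n + 9          ≤⟨ +-mono-≤ (m≤n*m n A {{>-nonZero (≤-trans (s≤s z≤n) 3≤A)}}) (*-mono-≤ 3≤A 3≤A) ⟩
  A * n + A * A  ≡⟨ σ₂-excess {A} {n} {1 + n} (σ₂[p*p] prime-p) eq ⟨
  1 + n + 3      ≡⟨ +-suc n 3 ⟨
  n + 4          ∎))
  where
  open ≤-Reasoning
  n : ℕ
  n = p * p

semiprime-solution : ∀ {A p q} → Prime p → Prime q → p < q → σ₂-Equation A (p * q) →
                     p * p + q * q + 4 ≡ A * p * q + A * A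
semiprime-solution {A} {p} {q} prime-p prime-q p<q eq = begin
  p * p + q * q + 4          ≡⟨ +-suc (p * p + q * q) 3 ⟩
  1 + p * p + q * q + 3      ≡⟨ σ₂-excess {A} {p * q} {1 + p * p + q * q} (σ₂[p*q] prime-p prime-q p<q) eq ⟩
  A * (p * q) + A * A        ≡⟨ cong (_+ A * A) (*-assoc A p q) ⟨
  A * p * q + A * A          ∎
  where open ≡-Reasoning

large-cofactor-bound : ∀ {A n p t} → A * A < n → σ₂-Equation A n → 2 ≤ p → p * p ≤ t → n ≡ p * t →
                       n < (1 + A) * (1 + A) * (1 + A)
large-cofactor-bound {A} {n} {p} {t} A²<n eq 2≤p p²≤t n≡p*t = cofactor-bound {1 + A} {n} {p} {t} t²<[1+A]n p²≤t n≡p*t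
  where
  open ≤-Reasoning
  4≤t : 4 ≤ t
  4≤t = ≤-trans (*-mono-≤ 2≤p 2≤p) p²≤t
  2≤t : 2 ≤ t
  2≤t = ≤-trans (s≤s (s≤s z≤n)) 4≤t
  t<n : t < n
  t<n = subst (t <_) (trans (*-comm t p) (sym n≡p*t)) (m<m*n t p {{>-nonZero (≤-trans (s≤s z≤n) 4≤t)}} 2≤p)
  t²<[1+A]n : t * t < (1 + A) * n
  t²<[1+A]n = begin-strict
    t * t                 <⟨ s≤s (m≤m+n (t * t) 3) ⟩
    1 + t * t + 3         ≤⟨ σ₂-excess-≤ {A} {n} {1 + t * t} (σ₂-lower 2≤t t<n (divides p n≡p*t)) eq ⟩
    A * n + A * A         ≤⟨ +-monoʳ-≤ (A * n) (<⇒≤ A²<n) ⟩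
    A * n + n             ≡⟨ +-comm (A * n) n ⟩
    (1 + A) * n           ∎

σ₂-equation⇒semiprime :
  ∀ {A n} → 3 ≤ A → σ₂-Equation A n → (1 + A) * (1 + A) * (1 + A) < n →
  Σ ℕ λ p → Σ ℕ λ q → Prime p × Prime q × p < q × n ≡ p * q × p * p + q * q + 4 ≡ A * p * q + A * A
σ₂-equation⇒semiprime {A} {n} 3≤A eq big = by-shape (shape n (≤-trans 2≤A*A (<⇒≤ A²<n)))
  where
  2≤A*A : 2 ≤ A * A
  2≤A*A = ≤-trans (s≤s (s≤s z≤n)) (*-mono-≤ 3≤A 3≤A)
  A²<n : A * A < n
  A²<n = ≤-<-trans (≤-trans (*-mono-≤ (n≤1+n A) (n≤1+n A)) (m≤m*n _ (1 + A))) big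
  by-shape : Shape n →
             Σ ℕ λ p → Σ ℕ λ q → Prime p × Prime q × p < q × n ≡ p * q × p * p + q * q + 4 ≡ A * p * q + A * A
  by-shape (isPrime prime-n) = ⊥-elim (prime-no-solution 3≤A eq prime-n)
  by-shape (primeSquare {p} prime-p n≡p*p) =
    ⊥-elim (prime-square-no-solution {A} {p} 3≤A (subst (σ₂-Equation A) n≡p*p eq) prime-p)
  by-shape (semiprime {p} {q} prime-p prime-q p<q n≡p*q) =
    p , q , prime-p , prime-q , p<q , n≡p*q ,
    semiprime-solution {A} prime-p prime-q p<q (subst (σ₂-Equation A) n≡p*q eq)
  by-shape (largeCofactor 2≤p p²≤t n≡p*t) =
    ⊥-elim (<-irrefl refl (<-trans big (large-cofactor-bound {A} A²<n eq 2≤p p²≤t n≡p*t)))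

n^3≡n*n*n : ∀ n → n ^ 3 ≡ n * n * n
n^3≡n*n*n n = trans (cong (λ s → n * (n * s)) (*-identityʳ n)) (sym (*-assoc n n n))

equation-without-∸ : ∀ {A n} → 3 ≤ A → σ₂ n ≡ n ^ 2 + (A * n + (A ^ 2 ∸ 3)) → σ₂-Equation A n
equation-without-∸ {A} {n} 3≤A σ₂≡ = begin
  σ₂ n + 3                              ≡⟨ cong (_+ 3) σ₂≡ ⟩
  n ^ 2 + (A * n + (A ^ 2 ∸ 3)) + 3     ≡⟨ regroup (n ^ 2) (A * n) (A ^ 2 ∸ 3) ⟩
  n ^ 2 + A * n + (A ^ 2 ∸ 3 + 3)       ≡⟨ cong (n ^ 2 + A * n +_) (m∸n+n≡m 3≤A²) ⟩
  n ^ 2 + A * n + A ^ 2                 ≡⟨ cong₂ (λ a b → a + A * n + b) (n^2≡n*n n) (n^2≡n*n A) ⟩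
  n * n + A * n + A * A                 ∎
  where
  open ≡-Reasoning
  3≤A² : 3 ≤ A ^ 2
  3≤A² = ≤-trans 3≤A (≤-trans (m≤m*n A A {{>-nonZero (≤-trans (s≤s z≤n) 3≤A)}}) (≤-reflexive (sym (n^2≡n*n A))))
  regroup : ∀ a b c → a + (b + c) + 3 ≡ a + b + (c + 3)
  regroup = solve-∀

bound-without-∸ : ∀ {A n} → 3 ≤ A → n > (A ^ 2 + A ∸ 3) ^ 3 → (1 + A) * (1 + A) * (1 + A) < n
bound-without-∸ {A} {n} 3≤A bound = ≤-<-trans (begin
  (1 + A) * (1 + A) * (1 + A)   ≡⟨ n^3≡n*n*n (1 + A) ⟨
  (1 + A) ^ 3                   ≤⟨ ^-monoˡ-≤ 3 1+A≤ ⟩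
  (A ^ 2 + A ∸ 3) ^ 3           ∎) bound
  where
  open ≤-Reasoning
  4≤A² : 4 ≤ A ^ 2
  4≤A² = ≤-trans (*-mono-≤ 2≤A 2≤A) (≤-reflexive (sym (n^2≡n*n A)))
    where
    2≤A : 2 ≤ A
    2≤A = ≤-trans (s≤s (s≤s z≤n)) 3≤A
  1+A≤ : 1 + A ≤ A ^ 2 + A ∸ 3
  1+A≤ = begin
    1 + A               ≤⟨ +-monoˡ-≤ A (m+n≤o⇒m≤o∸n 1 4≤A²) ⟩
    (A ^ 2 ∸ 3) + A     ≡⟨ +-∸-comm A (≤-trans (s≤s (s≤s (s≤s z≤n))) 4≤A²) ⟨
    A ^ 2 + A ∸ 3       ∎

theorem1p4 : (m : ℕ) → 0 < m → (n : ℕ) → 0 < n →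
    σ₂ n ≡ n ^ 2 + (L (2 * m) * n + (L (2 * m) ^ 2 ∸ 3)) →
    n > (L (2 * m) ^ 2 + L (2 * m) ∸ 3) ^ 3 →
    Σ ℕ (λ k → 0 < k × n ≡ L (2 * k ∸ 1) * L (2 * k + 2 * m ∸ 1)
                     × Prime (L (2 * k ∸ 1)) × Prime (L (2 * k + 2 * m ∸ 1)))
theorem1p4 m 0<m n _ σ₂≡ bound =
  let p , q , prime-p , prime-q , p<q , n≡p*q , p²+q²+4≡ =
        σ₂-equation⇒semiprime {L (2 * m)} {n} 3≤A (equation-without-∸ {L (2 * m)} {n} 3≤A σ₂≡)
          (bound-without-∸ {L (2 * m)} {n} 3≤A bound)
      k , 0<k , p≡ , q≡ = lucas-solutions {m} {p} {q} 0<m (≤-trans (s≤s z≤n) (prime≥2 prime-p)) p<q p²+q²+4≡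
  in k , 0<k , trans n≡p*q (cong₂ _*_ p≡ q≡) , subst Prime p≡ prime-p , subst Prime q≡ prime-q
  where
  3≤A : 3 ≤ L (2 * m)
  3≤A = L[2m]≥3 0<m
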